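{- Let $G$ be a $C_5$-component. If $G$ has a construction sequence in which every step is of type $(A_2)$ or $(A_3)$, then $G$ contains no cycle of length $3$ and no cycle of length $4$.
   Context: For graphs $G,F$, $\mathcal C_F(G)$ is the graph whose vertices are the copies of $F$ in $G$, two distinct copies adjacent if they share an edge; "$G$ is a $C_5$-component" means $G$ is the union of its $5$-cycles and $\mathcal C_{C_5}(G)$ is connected. A construction sequence of a $C_\ell$-component $G$ is a sequence $H_1\subseteq\dots\subseteq H_t=G$ where $H_1$ is an $\ell$-cycle in $G$ and for each $i\in[t-1]$ there is an $\ell$-cycle $C$ in $G$ with $C\not\subseteq H_i$, $E(C)\cap E(H_i)\neq\emptyset$ and $H_{i+1}=H_i\cup C$. A $j$-path is a path with $j$ vertices. Step $i$ is of type $(A_j)$ ($2\le j\le\ell$) if this cycle admits a labelling $C=u_1u_2\cdots u_\ell u_1$ such that $u_1u_2\cdots u_j$ is a $j$-path in $H_i$ and $u_{j+1},\dots,u_\ell\notin V(H_i)$. -}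

module Defs where

open import Data.Nat using (ℕ; zero; suc; _+_; _≤_; _<_)
open import Data.Nat.DivMod using (_%_; m%n<n)
open import Data.Fin using (Fin; toℕ; fromℕ<; inject₁) renaming (suc to fsuc)
open import Data.Product using (Σ; ∃; _×_; _,_)
open import Data.Sum using (_⊎_)
open import Relation.Nullary using (¬_)
open import Relation.Binary.PropositionalEquality using (_≡_)
open import Relation.Binary.Construct.Closure.ReflexiveTransitive using (Star)
open import Function.Definitions using (Injective)

record Graph (n : ℕ) : Set₁ where
  field
    Adj    : Fin n → Fin n → Set
    sym    : ∀ {x y} → Adj x y → Adj y x
    irrefl : ∀ {x} → ¬ Adj x x
open Graph public

next : ∀ {k} → Fin (suc k) → Fin (suc k)
next {k} i = fromℕ< (m%n<n (suc (toℕ i)) (suc k))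

record Cycle {n : ℕ} (ℓ : ℕ) (G : Graph n) : Set where
  field
    k   : ℕ
    len : ℓ ≡ suc k
    v   : Fin (suc k) → Fin n
    inj : Injective _≡_ _≡_ v
    adj : ∀ i → Adj G (v i) (v (next i))
open Cycle public

EdgeSet : ℕ → Set₁
EdgeSet n = Fin n → Fin n → Set

CEdge : ∀ {n ℓ} {G : Graph n} → Cycle ℓ G → EdgeSet n
CEdge C x y = ∃ λ i → (x ≡ v C i × y ≡ v C (next i)) ⊎ (y ≡ v C i × x ≡ v C (next i))

-- V(H) for a subgraph H that is a union of cycles (no isolated vertices)
InV : ∀ {n} → EdgeSet n → Fin n → Set
InV H x = ∃ λ y → H x y

_∪_ : ∀ {n} → EdgeSet n → EdgeSet n → EdgeSet n
(H ∪ K) x y = H x y ⊎ K x y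

_⊆E_ : ∀ {n} → EdgeSet n → EdgeSet n → Set
H ⊆E K = ∀ x y → H x y → K x y

SameCopy : ∀ {n ℓ} {G : Graph n} → Cycle ℓ G → Cycle ℓ G → Set
SameCopy C D = CEdge C ⊆E CEdge D × CEdge D ⊆E CEdge C

-- adjacency in C_{C5}(G): sharing an edge
ShareEdge : ∀ {n} {G : Graph n} → Cycle 5 G → Cycle 5 G → Set
ShareEdge {n} C D = ∃ λ x → ∃ λ y → CEdge C x y × CEdge D x y

IsC5Component : ∀ {n} → Graph n → Set
IsC5Component {n} G =
  (∀ (x : Fin n) → ∃ λ (C : Cycle 5 G) → ∃ λ i → v C i ≡ x)
  × (∀ x y → Adj G x y → ∃ λ (C : Cycle 5 G) → CEdge C x y)
  × (∀ (C D : Cycle 5 G) → Star ShareEdge C D)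

-- Step type (A_j) for adding the 5-cycle C to H: some labelling u₀…u₄ of the
-- copy C has u₀…u_{j-1} a j-path in H and u_j,…,u₄ ∉ V(H).
TypeA : ∀ {n} {G : Graph n} → ℕ → EdgeSet n → Cycle 5 G → Set
TypeA {n} {G} j H C = ∃ λ (D : Cycle 5 G) → SameCopy D C
  × (∀ (i : Fin (k D)) → suc (suc (toℕ i)) ≤ j → H (v D (inject₁ i)) (v D (fsuc i)))
  × (∀ i → toℕ i < j → InV H (v D i))
  × (∀ i → j ≤ toℕ i → ¬ InV H (v D i))

-- Remainder of a construction sequence of G starting from the current H_i,
-- where every step satisfies the predicate P.
data ConstrFrom {n} (G : Graph n) (P : EdgeSet n → Cycle 5 G → Set) : EdgeSet n → Set₁ where
  done : ∀ {H} → (∀ x y → Adj G x y → H x y) → ConstrFrom G P H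
  step : ∀ {H} (C : Cycle 5 G)
         → ¬ (CEdge C ⊆E H)
         → (∃ λ x → ∃ λ y → CEdge C x y × H x y)
         → P H C
         → ConstrFrom G P (H ∪ CEdge C)
         → ConstrFrom G P H

HasConstrSeq : ∀ {n} (G : Graph n) → (EdgeSet n → Cycle 5 G → Set) → Set₁
HasConstrSeq G P = ∃ λ (C₁ : Cycle 5 G) → ConstrFrom G P (CEdge C₁)

{-# OPTIONS --safe #-}
module Submission where

-- Induct along the construction sequence with the invariant that the union H built so far has
-- no 3- or 4-cycle. When a 5-cycle u₀…u₄ is added by a step of type (A_j), j ≤ 3, the fresh
-- vertices u_j,…,u₄ have no neighbours off the cycle, and H contains no chord of the cycle
-- (for j = 3 the only candidate, u₀u₂, would close a triangle in H). So every vertex of a short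
-- cycle through a fresh vertex lies on the new cycle and all its edges are cycle edges, which is
-- impossible in C₅; a short cycle avoiding the fresh vertices lies in H. The finitely many facts
-- about C₅ and its labels are decided by evaluation.

open import Defs
open import Data.Nat using (ℕ; suc; _≤_; _≤?_; z≤n; s≤s)
open import Data.Nat.Properties using (≤-refl; ≰⇒>; m≤n⇒m≤1+n)
open import Data.Fin using (Fin; toℕ; inject₁) renaming (zero to fz; suc to fs)
open import Data.Fin.Properties using (all?; any?; 0≢1+n; suc-injective) renaming (_≟_ to _≟ᶠ_)
open import Data.Product using (_×_; _,_; ∃)
open import Data.Sum using (_⊎_; inj₁; inj₂; [_,_]′; map₂)
open import Data.Empty using (⊥; ⊥-elim)
open import Function using (_∘_; id)
open import Function.Definitions using (Injective)
open import Relation.Nullary using (¬_; Dec; yes; no)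
open import Relation.Nullary.Decidable
  using (True; toWitness; from-yes; ¬?; _×-dec_; _⊎-dec_; _→-dec_)
open import Relation.Binary.PropositionalEquality
  using (_≡_; _≢_; refl; cong; trans) renaming (sym to ≡-sym)

CycAdj : Fin 5 → Fin 5 → Set
CycAdj i l = l ≡ next i ⊎ i ≡ next l

cycAdj? : ∀ i l → Dec (CycAdj i l)
cycAdj? i l = (l ≟ᶠ next i) ⊎-dec (i ≟ᶠ next l)

cycAdj-sym : ∀ {i l} → CycAdj i l → CycAdj l i
cycAdj-sym (inj₁ e) = inj₂ e
cycAdj-sym (inj₂ e) = inj₁ e

Fresh : ℕ → Fin 5 → Set
Fresh j i = j ≤ toℕ i

C₅-triangle-free : ∀ i l m → CycAdj i l → CycAdj l m → CycAdj m i → ⊥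
C₅-triangle-free = from-yes (all? λ i → all? λ l → all? λ m →
  cycAdj? i l →-dec cycAdj? l m →-dec cycAdj? m i →-dec no λ ())

C₅-square-free : ∀ i l p m → CycAdj i l → CycAdj l p → CycAdj p m → CycAdj m i
  → i ≢ p → l ≢ m → ⊥
C₅-square-free = from-yes (all? λ i → all? λ l → all? λ p → all? λ m →
  cycAdj? i l →-dec cycAdj? l p →-dec cycAdj? p m →-dec cycAdj? m i →-dec
  ¬? (i ≟ᶠ p) →-dec ¬? (l ≟ᶠ m) →-dec no λ ())

decide-≤3 : ∀ {P : ℕ → Set} (P? : ∀ j → Dec (P j))
  → {t₀ : True (P? 0)} {t₁ : True (P? 1)} {t₂ : True (P? 2)} {t₃ : True (P? 3)}
  → ∀ {j} → j ≤ 3 → P j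
decide-≤3 P? {t₀} z≤n = toWitness t₀
decide-≤3 P? {t₁ = t₁} (s≤s z≤n) = toWitness t₁
decide-≤3 P? {t₂ = t₂} (s≤s (s≤s z≤n)) = toWitness t₂
decide-≤3 P? {t₃ = t₃} (s≤s (s≤s (s≤s z≤n))) = toWitness t₃

fresh-has-fresh-neighbour : ∀ {j} → j ≤ 3 → ∀ i l m → Fresh j i → CycAdj i l → CycAdj i m
  → l ≢ m → Fresh j l ⊎ Fresh j m
fresh-has-fresh-neighbour = decide-≤3 λ j → all? λ i → all? λ l → all? λ m →
  (j ≤? toℕ i) →-dec cycAdj? i l →-dec cycAdj? i m →-dec ¬? (l ≟ᶠ m) →-dec
  ((j ≤? toℕ l) ⊎-dec (j ≤? toℕ m))

old-common-neighbour : ∀ {j} → j ≤ 3 → ∀ p m → ¬ Fresh j p → ¬ Fresh j m → p ≢ m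
  → ¬ CycAdj p m → ∃ λ q → ¬ Fresh j q × CycAdj p q × CycAdj q m
old-common-neighbour = decide-≤3 λ j → all? λ p → all? λ m →
  ¬? (j ≤? toℕ p) →-dec ¬? (j ≤? toℕ m) →-dec ¬? (p ≟ᶠ m) →-dec ¬? (cycAdj? p m) →-dec
  any? λ q → ¬? (j ≤? toℕ q) ×-dec cycAdj? p q ×-dec cycAdj? q m

NoTriangle : ∀ {n} → EdgeSet n → Set
NoTriangle {n} H = ∀ (a b c : Fin n) → H a b → H b c → H c a → ⊥

NoSquare : ∀ {n} → EdgeSet n → Set
NoSquare {n} H = ∀ (a b c d : Fin n) → a ≢ c → b ≢ d → H a b → H b c → H c d → H d a → ⊥

record ShortCycleFree {n} (G : Graph n) (H : EdgeSet n) : Set where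
  field
    symmetric     : ∀ {x y} → H x y → H y x
    ⊆-Adj         : ∀ {x y} → H x y → Adj G x y
    triangle-free : NoTriangle H
    square-free   : NoSquare H

module AddCycle {n} {G : Graph n} {H : EdgeSet n} (free : ShortCycleFree G H)
  {j : ℕ} (j≤3 : j ≤ 3)
  (w : Fin 5 → Fin n) (w-inj : Injective _≡_ _≡_ w) (w-adj : ∀ i → Adj G (w i) (w (next i)))
  (path : ∀ (i : Fin 4) → suc (suc (toℕ i)) ≤ j → H (w (inject₁ i)) (w (fs i)))
  (fresh-∉ : ∀ i → Fresh j i → ¬ InV H (w i)) where

  open ShortCycleFree free

  CycleEdge : EdgeSet n
  CycleEdge x y = ∃ λ i → (x ≡ w i × y ≡ w (next i)) ⊎ (y ≡ w i × x ≡ w (next i))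

  H′ : EdgeSet n
  H′ = H ∪ CycleEdge

  H′-sym : ∀ {x y} → H′ x y → H′ y x
  H′-sym (inj₁ h) = inj₁ (symmetric h)
  H′-sym (inj₂ (i , e)) = inj₂ (i , [ inj₂ , inj₁ ]′ e)

  H′⊆Adj : ∀ {x y} → H′ x y → Adj G x y
  H′⊆Adj (inj₁ h) = ⊆-Adj h
  H′⊆Adj (inj₂ (i , inj₁ (refl , refl))) = w-adj i
  H′⊆Adj (inj₂ (i , inj₂ (refl , refl))) = sym G (w-adj i)

  H′-irrefl : ∀ {x} → ¬ H′ x x
  H′-irrefl = irrefl G ∘ H′⊆Adj

  in-H⇒old : ∀ {i y} → H (w i) y → ¬ Fresh j i
  in-H⇒old h fi = fresh-∉ _ fi (_ , h)

  old-successor-edge : ∀ i → ¬ Fresh j i → ¬ Fresh j (next i) → H (w i) (w (next i))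
  old-successor-edge fz _ o = path fz (≰⇒> o)
  old-successor-edge (fs fz) _ o = path (fs fz) (≰⇒> o)
  old-successor-edge (fs (fs fz)) _ o = path (fs (fs fz)) (≰⇒> o)
  old-successor-edge (fs (fs (fs fz))) _ o = path (fs (fs (fs fz))) (≰⇒> o)
  old-successor-edge (fs (fs (fs (fs fz)))) o _ = ⊥-elim (o (m≤n⇒m≤1+n j≤3))

  old-cycle-edge : ∀ {l m} → ¬ Fresh j l → ¬ Fresh j m → CycAdj l m → H (w l) (w m)
  old-cycle-edge {l} ol om (inj₁ refl) = old-successor-edge l ol om
  old-cycle-edge {m = m} ol om (inj₂ refl) = symmetric (old-successor-edge m om ol)

  non-cycle-edge : ∀ {l m} → H′ (w l) (w m) → ¬ CycAdj l m → H (w l) (w m)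
  non-cycle-edge (inj₁ h) _ = h
  non-cycle-edge (inj₂ (a , inj₁ (p , q))) ¬lm =
    ⊥-elim (¬lm (inj₁ (trans (w-inj q) (cong next (≡-sym (w-inj p))))))
  non-cycle-edge (inj₂ (a , inj₂ (p , q))) ¬lm =
    ⊥-elim (¬lm (inj₂ (trans (w-inj q) (cong next (≡-sym (w-inj p))))))

  fresh-neighbour : ∀ {i y} → Fresh j i → H′ (w i) y → ∃ λ l → CycAdj i l × y ≡ w l
  fresh-neighbour fi (inj₁ h) = ⊥-elim (in-H⇒old h fi)
  fresh-neighbour fi (inj₂ (a , inj₁ (p , refl))) =
    next a , inj₁ (cong next (≡-sym (w-inj p))) , refl
  fresh-neighbour fi (inj₂ (a , inj₂ (refl , q))) = a , inj₂ (w-inj q) , refl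

  Old : Fin n → Set
  Old x = ∀ i → x ≡ w i → ¬ Fresh j i

  data Kind (x : Fin n) : Set where
    fresh : ∀ i → Fresh j i → x ≡ w i → Kind x
    old   : Old x → Kind x

  kind : ∀ x → Kind x
  kind x with any? (λ i → (x ≟ᶠ w i) ×-dec (j ≤? toℕ i))
  ... | yes (i , x≡wi , fi) = fresh i fi x≡wi
  ... | no ¬fresh = old λ i x≡wi fi → ¬fresh (i , x≡wi , fi)

  old-edge : ∀ {x y} → H′ x y → Old x → Old y → H x y
  old-edge (inj₁ h) _ _ = h
  old-edge (inj₂ (i , inj₁ (refl , refl))) ox oy =
    old-successor-edge i (ox i refl) (oy (next i) refl)
  old-edge (inj₂ (i , inj₂ (refl , refl))) ox oy =
    symmetric (old-successor-edge i (oy i refl) (ox (next i) refl))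

  H-chord-free : ∀ {p m} → H (w p) (w m) → ¬ CycAdj p m → ⊥
  H-chord-free {p} {m} h ¬pm =
    let q , oq , pq , qm = old-common-neighbour j≤3 p m op om (λ { refl → irrefl G (⊆-Adj h) }) ¬pm
    in triangle-free _ _ _ (old-cycle-edge op oq pq) (old-cycle-edge oq om qm) (symmetric h)
    where
    op = in-H⇒old h
    om = in-H⇒old (symmetric h)

  chord-free : ∀ {p m} → H′ (w p) (w m) → CycAdj p m
  chord-free {p} {m} e with cycAdj? p m
  ... | yes pm = pm
  ... | no ¬pm = ⊥-elim (H-chord-free (non-cycle-edge e ¬pm) ¬pm)

  fresh-triangle : ∀ {i b c} → Fresh j i → H′ (w i) b → H′ b c → H′ c (w i) → ⊥
  fresh-triangle fi ab bc ca with fresh-neighbour fi ab | fresh-neighbour fi (H′-sym ca)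
  ... | l , il , refl | m , im , refl = C₅-triangle-free _ _ _ il (chord-free bc) (cycAdj-sym im)

  fresh-square-side : ∀ {i l m c} → CycAdj i l → CycAdj i m → l ≢ m → Fresh j l
    → w i ≢ c → H′ (w l) c → H′ c (w m) → ⊥
  fresh-square-side il im l≢m fl a≢c bc cd with fresh-neighbour fl bc
  ... | p , lp , refl =
    C₅-square-free _ _ _ _ il lp (chord-free cd) (cycAdj-sym im) (λ { refl → a≢c refl }) l≢m

  fresh-square : ∀ {i b c d} → Fresh j i → w i ≢ c → b ≢ d
    → H′ (w i) b → H′ b c → H′ c d → H′ d (w i) → ⊥
  fresh-square fi a≢c b≢d ab bc cd da with fresh-neighbour fi ab | fresh-neighbour fi (H′-sym da)
  ... | l , il , refl | m , im , refl
    with fresh-has-fresh-neighbour j≤3 _ _ _ fi il im (b≢d ∘ cong w)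
  ...   | inj₁ fl = fresh-square-side il im (b≢d ∘ cong w) fl a≢c bc cd
  ...   | inj₂ fm =
    fresh-square-side im il (b≢d ∘ cong w ∘ ≡-sym) fm a≢c (H′-sym cd) (H′-sym bc)

  ∪-triangle-free : NoTriangle H′
  ∪-triangle-free a b c ab bc ca with kind a | kind b | kind c
  ... | fresh i fi refl | _ | _ = fresh-triangle fi ab bc ca
  ... | _ | fresh i fi refl | _ = fresh-triangle fi bc ca ab
  ... | _ | _ | fresh i fi refl = fresh-triangle fi ca ab bc
  ... | old oa | old ob | old oc =
    triangle-free a b c (old-edge ab oa ob) (old-edge bc ob oc) (old-edge ca oc oa)

  ∪-square-free : NoSquare H′
  ∪-square-free a b c d a≢c b≢d ab bc cd da with kind a | kind b | kind c | kind d
  ... | fresh i fi refl | _ | _ | _ = fresh-square fi a≢c b≢d ab bc cd da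
  ... | _ | fresh i fi refl | _ | _ = fresh-square fi b≢d (a≢c ∘ ≡-sym) bc cd da ab
  ... | _ | _ | fresh i fi refl | _ = fresh-square fi (a≢c ∘ ≡-sym) (b≢d ∘ ≡-sym) cd da ab bc
  ... | _ | _ | _ | fresh i fi refl = fresh-square fi (b≢d ∘ ≡-sym) a≢c da ab bc cd
  ... | old oa | old ob | old oc | old od =
    square-free a b c d a≢c b≢d
      (old-edge ab oa ob) (old-edge bc ob oc) (old-edge cd oc od) (old-edge da od oa)

  ∪-shortCycleFree : ShortCycleFree G H′
  ∪-shortCycleFree = record
    { symmetric     = H′-sym
    ; ⊆-Adj         = H′⊆Adj
    ; triangle-free = ∪-triangle-free
    ; square-free   = ∪-square-free
    }

∅ : ∀ {n} → EdgeSet n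
∅ _ _ = ⊥

module _ {n} {G : Graph n} where

  ShortCycleFree-resp : ∀ {H K : EdgeSet n} → H ⊆E K → K ⊆E H
    → ShortCycleFree G H → ShortCycleFree G K
  ShortCycleFree-resp H⊆K K⊆H free = record
    { symmetric     = λ k → H⊆K _ _ (symmetric (K⊆H _ _ k))
    ; ⊆-Adj         = λ k → ⊆-Adj (K⊆H _ _ k)
    ; triangle-free = λ a b c ab bc ca →
        triangle-free a b c (K⊆H _ _ ab) (K⊆H _ _ bc) (K⊆H _ _ ca)
    ; square-free   = λ a b c d a≢c b≢d ab bc cd da →
        square-free a b c d a≢c b≢d (K⊆H _ _ ab) (K⊆H _ _ bc) (K⊆H _ _ cd) (K⊆H _ _ da)
    }
    where open ShortCycleFree free

  ∪-monoʳ : ∀ {H K K′ : EdgeSet n} → K ⊆E K′ → (H ∪ K) ⊆E (H ∪ K′)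
  ∪-monoʳ K⊆K′ x y = map₂ (K⊆K′ x y)

  ∪-cycle : ∀ {H j} → ShortCycleFree G H → j ≤ 3 → (D : Cycle 5 G)
    → (∀ (i : Fin (k D)) → suc (suc (toℕ i)) ≤ j → H (v D (inject₁ i)) (v D (fs i)))
    → (∀ i → j ≤ toℕ i → ¬ InV H (v D i))
    → ShortCycleFree G (H ∪ CEdge D)
  ∪-cycle free j≤3 record { len = refl ; v = w ; inj = w-inj ; adj = w-adj } =
    AddCycle.∪-shortCycleFree free j≤3 w w-inj w-adj

  ∪-typeA : ∀ {H j} (C : Cycle 5 G) → ShortCycleFree G H → j ≤ 3 → TypeA j H C
    → ShortCycleFree G (H ∪ CEdge C)
  ∪-typeA C free j≤3 (D , (D⊆C , C⊆D) , path , _ , fresh) =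
    ShortCycleFree-resp (∪-monoʳ D⊆C) (∪-monoʳ C⊆D) (∪-cycle free j≤3 D path fresh)

  ∅-shortCycleFree : ShortCycleFree G ∅
  ∅-shortCycleFree = record
    { symmetric     = λ ()
    ; ⊆-Adj         = λ ()
    ; triangle-free = λ _ _ _ ()
    ; square-free   = λ _ _ _ _ _ _ ()
    }

  typeA₀-∅ : (C : Cycle 5 G) → TypeA 0 ∅ C
  typeA₀-∅ C = C , ((λ _ _ → id) , (λ _ _ → id)) , (λ _ ()) , (λ _ ()) , (λ _ _ ())

  cycle-shortCycleFree : (C : Cycle 5 G) → ShortCycleFree G (CEdge C)
  cycle-shortCycleFree C =
    ShortCycleFree-resp (λ _ _ → [ ⊥-elim , id ]′) (λ _ _ → inj₂)
      (∪-typeA C ∅-shortCycleFree z≤n (typeA₀-∅ C))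

  spanning-shortCycleFree : ∀ {H} → ShortCycleFree G H → (∀ x y → Adj G x y → H x y)
    → ¬ Cycle 3 G × ¬ Cycle 4 G
  spanning-shortCycleFree free G⊆H = no-triangle , no-square
    where
    open ShortCycleFree free
    no-triangle : ¬ Cycle 3 G
    no-triangle record { len = refl ; adj = u-adj } =
      triangle-free _ _ _
        (G⊆H _ _ (u-adj fz)) (G⊆H _ _ (u-adj (fs fz))) (G⊆H _ _ (u-adj (fs (fs fz))))
    no-square : ¬ Cycle 4 G
    no-square record { len = refl ; inj = u-inj ; adj = u-adj } =
      square-free _ _ _ _ (0≢1+n ∘ u-inj) (0≢1+n ∘ suc-injective ∘ u-inj)
        (G⊆H _ _ (u-adj fz)) (G⊆H _ _ (u-adj (fs fz)))
        (G⊆H _ _ (u-adj (fs (fs fz)))) (G⊆H _ _ (u-adj (fs (fs (fs fz)))))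

  constrFrom-shortCycleFree : ∀ {P H} → (∀ {H C} → P H C → ∃ λ j → j ≤ 3 × TypeA j H C)
    → ShortCycleFree G H → ConstrFrom G P H → ¬ Cycle 3 G × ¬ Cycle 4 G
  constrFrom-shortCycleFree steps free (done G⊆H) = spanning-shortCycleFree free G⊆H
  constrFrom-shortCycleFree steps free (step C _ _ pC rest) =
    let j , j≤3 , typeA = steps pC
    in constrFrom-shortCycleFree steps (∪-typeA C free j≤3 typeA) rest

mainTheorem13 : ∀ {n : ℕ} (G : Graph n) → IsC5Component G
    → HasConstrSeq G (λ H C → TypeA 2 H C ⊎ TypeA 3 H C)
    → ¬ Cycle 3 G × ¬ Cycle 4 G
mainTheorem13 G _ (C₁ , seq) =
  constrFrom-shortCycleFree (λ {H} {C} → A₂-or-A₃ {H} {C}) (cycle-shortCycleFree C₁) seq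
  where
  A₂-or-A₃ : ∀ {H} {C : Cycle 5 G} → TypeA 2 H C ⊎ TypeA 3 H C → ∃ λ j → j ≤ 3 × TypeA j H C
  A₂-or-A₃ (inj₁ t) = 2 , s≤s (s≤s z≤n) , t
  A₂-or-A₃ (inj₂ t) = 3 , ≤-refl , t
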